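{- Consider two instances $\mathcal I,\mathcal I'$ on the same $n$ candidates and $p$ institutions, with the same estimated utilities (pairwise distinct) and the same preference lists of the candidates. For each $\ell\in[p]$ let $k_\ell$ and $k'_\ell$ be the capacity of institution $\ell$ in $\mathcal I$ and $\mathcal I'$ respectively, and let $D=\sum_{\ell}|k_\ell-k'_\ell|$. Then the assignments output by $\mathcal A_{\rm st}$ on the two instances differ on at most $p\cdot D$ candidates.
   Context: Each candidate $i$ has an estimated utility $\hat u_i$ and a preference list $\sigma_i$ (a ranking of the $p$ institutions). Algorithm $\mathcal A_{\rm st}$: consider candidates in decreasing order of $\hat u_i$ and assign each to its most preferred institution that still has a vacant slot (leaving it unassigned if none remains); this is the unique stable assignment when all institutions rank candidates by $\hat u$. -}

module Defs where

open import Level using (Level)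
open import Data.Nat using (ℕ; zero; suc; _+_; ∣_-_∣)
open import Data.Fin using (Fin)
open import Data.Fin.Permutation using (Permutation′; _⟨$⟩ʳ_)
open import Data.Fin.Properties using (_≟_)
open import Data.List using (List; []; _∷_; allFin; length; filter; foldr; map)
open import Data.Nat.ListAction using (sum)
open import Data.Maybe using (Maybe; just; nothing)
open import Data.Maybe.Properties using (≡-dec)
open import Data.Product using (_×_; _,_)
open import Relation.Nullary using (¬?; does)
open import Relation.Binary.PropositionalEquality using (_≡_)
open import Relation.Binary.Bundles using (StrictTotalOrder)
open import Data.Bool using (true; false; if_then_else_)

-- A preference list of a candidate is a permutation of the p institutions:
-- rank r (r = 0 most preferred) is mapped to the institution  σ ⟨$⟩ʳ r .
PrefList : ℕ → Set
PrefList p = Permutation′ p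

Capacities : ℕ → Set
Capacities p = Fin p → ℕ

Assignment : ℕ → ℕ → Set
Assignment n p = Fin n → Maybe (Fin p)

decCap : ∀ {p} → Capacities p → Fin p → Capacities p
decCap {p} k l l' with does (l ≟ l')
... | true  = Data.Nat.pred (k l')
... | false = k l'

firstVacant : ∀ {p} → Capacities p → List (Fin p) → Maybe (Fin p)
firstVacant k [] = nothing
firstVacant k (l ∷ ls) with k l
... | zero  = firstVacant k ls
... | suc _ = just l

prefOrder : ∀ {p} → PrefList p → List (Fin p)
prefOrder σ = map (σ ⟨$⟩ʳ_) (allFin _)

module StableAlgorithm {c ℓ₁ ℓ₂ : Level} (U : StrictTotalOrder c ℓ₁ ℓ₂) where
  open StrictTotalOrder U using (_<?_) renaming (Carrier to Utility)

  module _ {n p : ℕ} (û : Fin n → Utility) where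

    insertDesc : Fin n → List (Fin n) → List (Fin n)
    insertDesc i [] = i ∷ []
    insertDesc i (j ∷ js) with does (û j <? û i)
    ... | true  = i ∷ j ∷ js
    ... | false = j ∷ insertDesc i js

    byDecreasingUtility : List (Fin n)
    byDecreasingUtility = foldr insertDesc [] (allFin n)

    process : (Fin n → PrefList p) → List (Fin n) → Capacities p
            → Assignment n p → Assignment n p
    process σ [] k a = a
    process σ (i ∷ is) k a with firstVacant k (prefOrder (σ i))
    ... | nothing = process σ is k a
    ... | just l  = process σ is (decCap k l) (λ j → if does (i ≟ j) then just l else a j)

    A-st : (Fin n → PrefList p) → Capacities p → Assignment n p
    A-st σ k = process σ byDecreasingUtility k (λ _ → nothing)

numDiffer : ∀ {n p} → Assignment n p → Assignment n p → ℕ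
numDiffer {n} a b = length (filter (λ i → ¬? (≡-dec _≟_ (a i) (b i))) (allFin n))

capDistance : ∀ {p} → Capacities p → Capacities p → ℕ
capDistance {p} k k' = sum (map (λ l → ∣ k l - k' l ∣) (allFin p))

-- Compare the runs of A_st under capacities r and r′, where r′ has one extra slot at an
-- institution x. The runs make the same choices until some candidate, finding x full under r,
-- takes the extra slot under r′; under r it takes another institution b (or nothing), after which
-- the remaining capacities again differ by a single slot, now at b. Each such displacement changes
-- the assignment of one candidate and fills x for good in the r′-run, so the number of institutions
-- with a vacant slot in the r′-run drops: at most p candidates end up assigned differently.
-- Arbitrary capacity vectors are joined by capDistance unit changes, and counting the candidates
-- on which two assignments differ satisfies the triangle inequality.
module Submission where

open import Defs
open import Level using (Level; 0ℓ)
open import Function using (_∘_; id)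
open import Data.Bool using (if_then_else_)
open import Data.Nat
  using (ℕ; zero; suc; pred; _+_; _*_; _∸_; ∣_-_∣; _≤_; _<_; z≤n; s≤s; _<?_; >-nonZero)
  renaming (_≟_ to _≟ℕ_)
open import Data.Nat.Properties
  using ( ≤-refl; ≤-reflexive; ≤-trans; <-≤-trans; <-irrefl; <-cmp; n≤1+n; m≤n⇒m≤1+n; m≤m+n
        ; n≤0⇒n≡0; suc-injective; suc-pred; pred[n]≤n; pred-mono-≤
        ; +-comm; +-suc; *-suc; +-mono-≤; +-monoˡ-≤; +-monoʳ-≤; +-∸-assoc; m+n≡0⇒m≡0; m+n≡0⇒n≡0
        ; ∣-∣-comm; ∣m-n∣≡0⇒m≡n; m≡n⇒∣m-n∣≡0; m≤n⇒∣m-n∣≡n∸m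
        ; module ≤-Reasoning )
open import Data.Fin using (Fin; zero; suc)
open import Data.Fin.Properties using (_≟_)
open import Data.Maybe using (just; nothing)
open import Data.Maybe.Properties using (≡-dec)
import Data.Fin.Properties as Fin
open import Data.List using (List; []; _∷_; length; filter; tabulate; allFin)
open import Data.List.Properties using (tabulate-cong; map-tabulate; map-cong)
open import Data.Nat.ListAction using (sum)
open import Data.Product using (_,_; _×_; ∃; ∃₂; map)
open import Data.Sum using (_⊎_; inj₁; inj₂)
open import Relation.Nullary using (¬_; ¬?; yes; no; does; contradiction)
open import Relation.Unary using (Pred; Decidable; Empty; _⊆_; _∪_)
open import Relation.Binary using (tri<; tri≈; tri>)
open import Relation.Binary.Bundles using (StrictTotalOrder)
open import Relation.Binary.PropositionalEquality
  using (_≡_; _≢_; _≗_; refl; sym; trans; cong; cong₂; module ≡-Reasoning)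

private
  variable
    ℓ ℓ′ ℓ″ : Level
    m n p : ℕ

-- Counting decidable predicates on Fin m

count : {P : Pred (Fin m) ℓ} → Decidable P → ℕ
count {m = zero}  P? = 0
count {m = suc m} P? = (if does (P? zero) then suc else id) (count (P? ∘ suc))

count≤ : {P : Pred (Fin m) ℓ} (P? : Decidable P) → count P? ≤ m
count≤ {m = zero}  P? = z≤n
count≤ {m = suc m} P? with P? zero
... | yes _ = s≤s (count≤ (P? ∘ suc))
... | no _  = m≤n⇒m≤1+n (count≤ (P? ∘ suc))

count-tail≤ : {P : Pred (Fin (suc m)) ℓ} (P? : Decidable P) → count (P? ∘ suc) ≤ count P?
count-tail≤ P? with P? zero
... | yes _ = n≤1+n _
... | no _  = ≤-refl

count-∅ : {P : Pred (Fin m) ℓ} (P? : Decidable P) → Empty P → count P? ≡ 0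
count-∅ {m = zero}  P? ∅ = refl
count-∅ {m = suc m} P? ∅ with P? zero
... | yes p = contradiction p (∅ zero)
... | no _  = count-∅ (P? ∘ suc) (∅ ∘ suc)

count-mono : {P : Pred (Fin m) ℓ} {Q : Pred (Fin m) ℓ′} (P? : Decidable P) (Q? : Decidable Q) →
             P ⊆ Q → count P? ≤ count Q?
count-mono {m = zero}  P? Q? P⊆Q = z≤n
count-mono {m = suc m} P? Q? P⊆Q with P? zero
... | no _  = ≤-trans (count-mono (P? ∘ suc) (Q? ∘ suc) P⊆Q) (count-tail≤ Q?)
... | yes p with Q? zero
...   | yes _ = s≤s (count-mono (P? ∘ suc) (Q? ∘ suc) P⊆Q)
...   | no ¬q = contradiction (P⊆Q p) ¬q

count-⊂ : {P : Pred (Fin m) ℓ} {Q : Pred (Fin m) ℓ′} (P? : Decidable P) (Q? : Decidable Q) →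
          P ⊆ Q → ∀ i → Q i → ¬ P i → count P? < count Q?
count-⊂ P? Q? P⊆Q zero    qi ¬pi with P? zero | Q? zero
... | yes pi | _     = contradiction pi ¬pi
... | no _   | yes _ = s≤s (count-mono (P? ∘ suc) (Q? ∘ suc) P⊆Q)
... | no _   | no ¬q = contradiction qi ¬q
count-⊂ P? Q? P⊆Q (suc i) qi ¬pi with P? zero
... | no _  = ≤-trans (count-⊂ (P? ∘ suc) (Q? ∘ suc) P⊆Q i qi ¬pi) (count-tail≤ Q?)
... | yes p with Q? zero
...   | yes _ = s≤s (count-⊂ (P? ∘ suc) (Q? ∘ suc) P⊆Q i qi ¬pi)
...   | no ¬q = contradiction (P⊆Q p) ¬q

count-∪ : {P : Pred (Fin m) ℓ} {Q : Pred (Fin m) ℓ′} {R : Pred (Fin m) ℓ″}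
          (P? : Decidable P) (Q? : Decidable Q) (R? : Decidable R) →
          P ⊆ Q ∪ R → count P? ≤ count Q? + count R?
count-∪ {m = zero}  P? Q? R? P⊆Q∪R = z≤n
count-∪ {m = suc m} P? Q? R? P⊆Q∪R with P? zero
... | no _ = ≤-trans (count-∪ (P? ∘ suc) (Q? ∘ suc) (R? ∘ suc) P⊆Q∪R)
                     (+-mono-≤ (count-tail≤ Q?) (count-tail≤ R?))
... | yes p with Q? zero
...   | yes _ = s≤s (≤-trans (count-∪ (P? ∘ suc) (Q? ∘ suc) (R? ∘ suc) P⊆Q∪R)
                             (+-monoʳ-≤ _ (count-tail≤ R?)))
...   | no ¬q with R? zero | P⊆Q∪R p
...     | yes _ | _      = ≤-trans (s≤s (count-∪ (P? ∘ suc) (Q? ∘ suc) (R? ∘ suc) P⊆Q∪R))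
                                   (≤-reflexive (sym (+-suc _ _)))
...     | no _  | inj₁ q = contradiction q ¬q
...     | no ¬r | inj₂ r = contradiction r ¬r

count-≡≤1 : (i : Fin m) → count (_≟ i) ≤ 1
count-≡≤1 {m = suc m} zero    = ≤-reflexive (cong suc (count-∅ {m = m} (λ j → suc j ≟ zero) λ _ ()))
count-≡≤1 {m = suc m} (suc i) =
  ≤-trans (count-mono (λ j → suc j ≟ suc i) (_≟ i) Fin.suc-injective) (count-≡≤1 i)

length-filter-tabulate : ∀ {a} {A : Set a} {P : Pred A ℓ} (P? : Decidable P) (f : Fin m → A) →
                         length (filter P? (tabulate f)) ≡ count (P? ∘ f)
length-filter-tabulate {m = zero}  P? f = refl
length-filter-tabulate {m = suc m} P? f with P? (f zero)
... | yes _ = cong suc (length-filter-tabulate P? (f ∘ suc))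
... | no _  = length-filter-tabulate P? (f ∘ suc)

-- Unit changes of capacity vectors

record OneMoreAt (x : Fin m) (f g : Fin m → ℕ) : Set where
  field
    at     : g x ≡ suc (f x)
    others : ∀ {j} → j ≢ x → g j ≡ f j

open OneMoreAt

sum-tabulate-OneMoreAt : {x : Fin m} {f g : Fin m → ℕ} → OneMoreAt x f g →
                         sum (tabulate g) ≡ suc (sum (tabulate f))
sum-tabulate-OneMoreAt {x = zero} f⋖g =
  cong₂ _+_ (at f⋖g) (cong sum (tabulate-cong λ j → others f⋖g {suc j} λ ()))
sum-tabulate-OneMoreAt {x = suc x} {f} {g} f⋖g = begin
  g zero + sum (tabulate (g ∘ suc))         ≡⟨ cong₂ _+_ (others f⋖g λ ()) (sum-tabulate-OneMoreAt tail) ⟩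
  f zero + suc (sum (tabulate (f ∘ suc)))   ≡⟨ +-suc (f zero) _ ⟩
  suc (f zero + sum (tabulate (f ∘ suc)))   ∎
  where
  open ≡-Reasoning
  tail : OneMoreAt x (f ∘ suc) (g ∘ suc)
  tail = record { at = at f⋖g ; others = λ j≢x → others f⋖g (j≢x ∘ Fin.suc-injective) }

sum-tabulate≡0 : (f : Fin m → ℕ) → sum (tabulate f) ≡ 0 → ∀ l → f l ≡ 0
sum-tabulate≡0 f Σf≡0 zero    = m+n≡0⇒m≡0 (f zero) Σf≡0
sum-tabulate≡0 f Σf≡0 (suc l) = sum-tabulate≡0 (f ∘ suc) (m+n≡0⇒n≡0 (f zero) Σf≡0) l

sum-tabulate≢0 : ∀ (f : Fin m → ℕ) {d} → sum (tabulate f) ≡ suc d → ∃ λ l → f l ≢ 0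
sum-tabulate≢0 {m = suc m} f Σf≡1+d with f zero ≟ℕ 0
... | no f₀≢0 = zero , f₀≢0
... | yes f₀≡0 =
  map suc id (sum-tabulate≢0 (f ∘ suc) (trans (cong (_+ sum (tabulate (f ∘ suc))) (sym f₀≡0)) Σf≡1+d))

OneMoreAt-respʳ : {x : Fin m} {f g h : Fin m → ℕ} → OneMoreAt x f g → g ≗ h → OneMoreAt x f h
OneMoreAt-respʳ f⋖g g≗h = record
  { at     = trans (sym (g≗h _)) (at f⋖g)
  ; others = λ j≢x → trans (sym (g≗h _)) (others f⋖g j≢x) }

OneMoreAt-∣-∣ : {x : Fin m} {f g : Fin m → ℕ} (h : Fin m → ℕ) → OneMoreAt x f g → h x ≤ f x →
                OneMoreAt x (λ l → ∣ h l - f l ∣) (λ l → ∣ h l - g l ∣)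
OneMoreAt-∣-∣ {x = x} {f} {g} h f⋖g hₓ≤fₓ = record
  { at     = begin
      ∣ h x - g x ∣        ≡⟨ cong ∣ h x -_∣ (at f⋖g) ⟩
      ∣ h x - suc (f x) ∣  ≡⟨ m≤n⇒∣m-n∣≡n∸m (m≤n⇒m≤1+n hₓ≤fₓ) ⟩
      suc (f x) ∸ h x      ≡⟨ +-∸-assoc 1 hₓ≤fₓ ⟩
      suc (f x ∸ h x)      ≡⟨ cong suc (m≤n⇒∣m-n∣≡n∸m hₓ≤fₓ) ⟨
      suc ∣ h x - f x ∣    ∎
  ; others = λ j≢x → cong ∣ h _ -_∣ (others f⋖g j≢x) }
  where open ≡-Reasoning

decCap-self : (k : Capacities p) (l : Fin p) → decCap k l l ≡ pred (k l)
decCap-self k l with l ≟ l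
... | yes _   = refl
... | no l≢l = contradiction refl l≢l

decCap-other : (k : Capacities p) {l j : Fin p} → l ≢ j → decCap k l j ≡ k j
decCap-other k {l} {j} l≢j with l ≟ j
... | yes l≡j = contradiction l≡j l≢j
... | no _    = refl

decCap-≤ : (k : Capacities p) (l j : Fin p) → decCap k l j ≤ k j
decCap-≤ k l j with l ≟ j
... | yes _ = pred[n]≤n
... | no _  = ≤-refl

decCap-cong : {k k′ : Capacities p} → k ≗ k′ → ∀ l → decCap k l ≗ decCap k′ l
decCap-cong k≗k′ l j with l ≟ j
... | yes _ = cong pred (k≗k′ j)
... | no _  = k≗k′ j

decCap-OneMoreAt : (k : Capacities p) {x : Fin p} → 0 < k x → OneMoreAt x (decCap k x) k
decCap-OneMoreAt k {x} 0<kₓ = record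
  { at     = trans (sym (suc-pred (k x) ⦃ >-nonZero 0<kₓ ⦄)) (cong suc (sym (decCap-self k x)))
  ; others = λ j≢x → sym (decCap-other k (j≢x ∘ sym)) }

OneMoreAt⇒≗decCap : {x : Fin p} {r r′ : Capacities p} → OneMoreAt x r r′ → r ≗ decCap r′ x
OneMoreAt⇒≗decCap {x = x} {r} {r′} r⋖r′ j with j ≟ x
... | yes refl = sym (trans (decCap-self r′ x) (cong pred (at r⋖r′)))
... | no j≢x   = sym (trans (decCap-other r′ (j≢x ∘ sym)) (others r⋖r′ j≢x))

OneMoreAt-decCap : {x l : Fin p} {r r′ : Capacities p} → 0 < r l → OneMoreAt x r r′ →
                   OneMoreAt x (decCap r l) (decCap r′ l)
OneMoreAt-decCap {x = x} {l} {r} {r′} 0<rₗ r⋖r′ = record { at = at′ ; others = others′ }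
  where
  at′ : decCap r′ l x ≡ suc (decCap r l x)
  at′ with l ≟ x
  ... | yes refl = trans (cong pred (at r⋖r′)) (sym (suc-pred (r l) ⦃ >-nonZero 0<rₗ ⦄))
  ... | no _     = at r⋖r′
  others′ : ∀ {j} → j ≢ x → decCap r′ l j ≡ decCap r l j
  others′ {j} j≢x with l ≟ j
  ... | yes _ = cong pred (others r⋖r′ j≢x)
  ... | no _  = others r⋖r′ j≢x

capDistance-tabulate : (k k′ : Capacities p) → capDistance k k′ ≡ sum (tabulate λ l → ∣ k l - k′ l ∣)
capDistance-tabulate k k′ = cong sum (map-tabulate id (λ l → ∣ k l - k′ l ∣))

capDistance-comm : (k k′ : Capacities p) → capDistance k k′ ≡ capDistance k′ k
capDistance-comm {p} k k′ = cong sum (map-cong (λ l → ∣-∣-comm (k l) (k′ l)) (allFin p))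

capDistance≡0⇒≗ : {k k′ : Capacities p} → capDistance k k′ ≡ 0 → k ≗ k′
capDistance≡0⇒≗ {k = k} {k′} dist≡0 l =
  ∣m-n∣≡0⇒m≡n (sum-tabulate≡0 _ (trans (sym (capDistance-tabulate k k′)) dist≡0) l)

capDistance-decCapʳ : (k k′ : Capacities p) {x : Fin p} → k x < k′ x →
                      capDistance k k′ ≡ suc (capDistance k (decCap k′ x))
capDistance-decCapʳ k k′ {x} kₓ<k′ₓ = begin
  capDistance k k′                                   ≡⟨ capDistance-tabulate k k′ ⟩
  sum (tabulate λ l → ∣ k l - k′ l ∣)                ≡⟨ sum-tabulate-OneMoreAt (OneMoreAt-∣-∣ k k′ₓ⁻¹⋖k′ kₓ≤k′ₓ⁻¹) ⟩
  suc (sum (tabulate λ l → ∣ k l - decCap k′ x l ∣)) ≡⟨ cong suc (capDistance-tabulate k (decCap k′ x)) ⟨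
  suc (capDistance k (decCap k′ x))                  ∎
  where
  open ≡-Reasoning
  k′ₓ⁻¹⋖k′ : OneMoreAt x (decCap k′ x) k′
  k′ₓ⁻¹⋖k′ = decCap-OneMoreAt k′ (≤-trans (s≤s z≤n) kₓ<k′ₓ)
  kₓ≤k′ₓ⁻¹ : k x ≤ decCap k′ x x
  kₓ≤k′ₓ⁻¹ = ≤-trans (pred-mono-≤ kₓ<k′ₓ) (≤-reflexive (sym (decCap-self k′ x)))

capDistance-step : {k k′ : Capacities p} {d : ℕ} → capDistance k k′ ≡ suc d →
                   ∃₂ λ x r → (OneMoreAt x r k′ × capDistance k r ≡ d)
                            ⊎ (OneMoreAt x r k × capDistance r k′ ≡ d)
capDistance-step {k = k} {k′} dist with sum-tabulate≢0 _ (trans (sym (capDistance-tabulate k k′)) dist)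
... | l , ∣kₗ-k′ₗ∣≢0 with <-cmp (k l) (k′ l)
...   | tri≈ _ kₗ≡k′ₗ _ = contradiction (m≡n⇒∣m-n∣≡0 kₗ≡k′ₗ) ∣kₗ-k′ₗ∣≢0
...   | tri< kₗ<k′ₗ _ _ = l , decCap k′ l , inj₁
  ( decCap-OneMoreAt k′ (≤-trans (s≤s z≤n) kₗ<k′ₗ)
  , suc-injective (trans (sym (capDistance-decCapʳ k k′ kₗ<k′ₗ)) dist) )
...   | tri> _ _ k′ₗ<kₗ = l , decCap k l , inj₂
  ( decCap-OneMoreAt k (≤-trans (s≤s z≤n) k′ₗ<kₗ)
  , suc-injective (begin
      suc (capDistance (decCap k l) k′) ≡⟨ cong suc (capDistance-comm (decCap k l) k′) ⟩
      suc (capDistance k′ (decCap k l)) ≡⟨ capDistance-decCapʳ k′ k k′ₗ<kₗ ⟨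
      capDistance k′ k                  ≡⟨ capDistance-comm k′ k ⟩
      capDistance k k′                  ≡⟨ dist ⟩
      suc _                             ∎) )
  where open ≡-Reasoning

module _ (δ : Capacities p → Capacities p → ℕ) (c : ℕ)
         (δ-≗ : ∀ {k k′} → k ≗ k′ → δ k k′ ≡ 0)
         (δ-sym : ∀ k k′ → δ k k′ ≤ δ k′ k)
         (δ-triangle : ∀ k k′ k″ → δ k k″ ≤ δ k k′ + δ k′ k″)
         (δ-OneMoreAt : ∀ {x r r′} → OneMoreAt x r r′ → δ r r′ ≤ c)
  where

  capDistance-Lipschitz : ∀ k k′ → δ k k′ ≤ c * capDistance k k′
  capDistance-Lipschitz k k′ = bound (capDistance k k′) refl
    where
    open ≤-Reasoning
    bound : ∀ d {k k′} → capDistance k k′ ≡ d → δ k k′ ≤ c * d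
    bound zero    dist = ≤-trans (≤-reflexive (δ-≗ (capDistance≡0⇒≗ dist))) z≤n
    bound (suc d) {k} {k′} dist with capDistance-step dist
    ... | x , r , inj₁ (r⋖k′ , dist′) = begin
      δ k k′          ≤⟨ δ-triangle k r k′ ⟩
      δ k r + δ r k′  ≤⟨ +-mono-≤ (bound d dist′) (δ-OneMoreAt r⋖k′) ⟩
      c * d + c       ≡⟨ +-comm (c * d) c ⟩
      c + c * d       ≡⟨ *-suc c d ⟨
      c * suc d       ∎
    ... | x , r , inj₂ (r⋖k , dist′) = begin
      δ k k′          ≤⟨ δ-triangle k r k′ ⟩
      δ k r + δ r k′  ≤⟨ +-mono-≤ (≤-trans (δ-sym k r) (δ-OneMoreAt r⋖k)) (bound d dist′) ⟩
      c + c * d       ≡⟨ *-suc c d ⟨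
      c * suc d       ∎

-- Differences between assignments

Differ : Assignment n p → Assignment n p → Pred (Fin n) 0ℓ
Differ a b j = a j ≢ b j

differ? : (a b : Assignment n p) → Decidable (Differ a b)
differ? a b j = ¬? (≡-dec _≟_ (a j) (b j))

differences : Assignment n p → Assignment n p → ℕ
differences a b = count (differ? a b)

numDiffer≡differences : (a b : Assignment n p) → numDiffer a b ≡ differences a b
numDiffer≡differences a b = length-filter-tabulate (differ? a b) id

differences-self : (a : Assignment n p) → differences a a ≡ 0
differences-self a = count-∅ (differ? a a) λ _ a≢a → a≢a refl

differences-sym : (a b : Assignment n p) → differences a b ≤ differences b a
differences-sym a b = count-mono (differ? a b) (differ? b a) (_∘ sym)

differences-triangle : (a b c : Assignment n p) → differences a c ≤ differences a b + differences b c
differences-triangle a b c = count-∪ (differ? a c) (differ? a b) (differ? b c) Differ-trans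
  where
  Differ-trans : Differ a c ⊆ Differ a b ∪ Differ b c
  Differ-trans {j} aⱼ≢cⱼ with ≡-dec _≟_ (a j) (b j)
  ... | yes aⱼ≡bⱼ = inj₂ λ bⱼ≡cⱼ → aⱼ≢cⱼ (trans aⱼ≡bⱼ bⱼ≡cⱼ)
  ... | no aⱼ≢bⱼ  = inj₁ aⱼ≢bⱼ

differences-agreeOutside : {a a′ b b′ : Assignment n p} (i : Fin n) →
  (∀ {j} → j ≢ i → b j ≡ a j) → (∀ {j} → j ≢ i → b′ j ≡ a′ j) →
  differences b b′ ≤ suc (differences a a′)
differences-agreeOutside {a = a} {a′} {b} {b′} i b≈a b′≈a′ = begin
  differences b b′                        ≤⟨ count-∪ (differ? b b′) (differ? a a′) (_≟ i) Differ-off ⟩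
  differences a a′ + count (_≟ i)         ≤⟨ +-monoʳ-≤ (differences a a′) (count-≡≤1 i) ⟩
  differences a a′ + 1                    ≡⟨ +-comm (differences a a′) 1 ⟩
  suc (differences a a′)                  ∎
  where
  open ≤-Reasoning
  Differ-off : Differ b b′ ⊆ Differ a a′ ∪ (_≡ i)
  Differ-off {j} bⱼ≢b′ⱼ with j ≟ i
  ... | yes j≡i = inj₂ j≡i
  ... | no j≢i  = inj₁ λ aⱼ≡a′ⱼ → bⱼ≢b′ⱼ (trans (b≈a j≢i) (trans aⱼ≡a′ⱼ (sym (b′≈a′ j≢i))))

assign : Fin n → Fin p → Assignment n p → Assignment n p
assign i l a j = if does (i ≟ j) then just l else a j

assign-other : (i : Fin n) (l : Fin p) (a : Assignment n p) {j : Fin n} → j ≢ i → assign i l a j ≡ a j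
assign-other i l a {j} j≢i with i ≟ j
... | yes i≡j = contradiction (sym i≡j) j≢i
... | no _    = refl

differences-assign : (i : Fin n) (l : Fin p) (a a′ : Assignment n p) →
                     differences (assign i l a) (assign i l a′) ≤ differences a a′
differences-assign i l a a′ = count-mono (differ? _ _) (differ? a a′) Differ-assign
  where
  Differ-assign : Differ (assign i l a) (assign i l a′) ⊆ Differ a a′
  Differ-assign {j} with i ≟ j
  ... | yes _ = λ l≢l → contradiction refl l≢l
  ... | no _  = id

-- The run of A_st under a unit change of capacities

vacancies : Capacities p → ℕ
vacancies r = count (λ l → 0 <? r l)

vacancies-decCap : (r : Capacities p) (l : Fin p) → vacancies (decCap r l) ≤ vacancies r
vacancies-decCap r l = count-mono (λ j → 0 <? decCap r l j) (λ j → 0 <? r j)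
  (λ {j} 0<rₗ⁻¹ → <-≤-trans 0<rₗ⁻¹ (decCap-≤ r l j))

vacancies-decCap-< : (r : Capacities p) {x : Fin p} → r x ≡ 1 → vacancies (decCap r x) < vacancies r
vacancies-decCap-< r {x} rₓ≡1 = count-⊂ (λ j → 0 <? decCap r x j) (λ j → 0 <? r j)
  (λ {j} 0<rₓ⁻¹ → <-≤-trans 0<rₓ⁻¹ (decCap-≤ r x j)) x
  (≤-reflexive (sym rₓ≡1))
  (λ 0<rₓ⁻¹ → <-irrefl refl (≤-trans 0<rₓ⁻¹ (≤-reflexive (trans (decCap-self r x) (cong pred rₓ≡1)))))

firstVacant-cong : {r r′ : Capacities p} → r ≗ r′ → ∀ ls → firstVacant r ls ≡ firstVacant r′ ls
firstVacant-cong r≗r′ [] = refl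
firstVacant-cong {r = r} {r′} r≗r′ (l ∷ ls) with r l | r′ l | r≗r′ l
... | zero  | .zero    | refl = firstVacant-cong r≗r′ ls
... | suc _ | .(suc _) | refl = refl

firstVacant-vacant : (r : Capacities p) (ls : List (Fin p)) {l : Fin p} → firstVacant r ls ≡ just l → 0 < r l
firstVacant-vacant r (l′ ∷ ls) choice with r l′ in rₗ′
... | zero  = firstVacant-vacant r ls choice
... | suc _ with refl ← choice = ≤-trans (s≤s z≤n) (≤-reflexive (sym rₗ′))

firstVacant-OneMoreAt : {x : Fin p} {r r′ : Capacities p} → OneMoreAt x r r′ → ∀ ls →
  firstVacant r ls ≡ firstVacant r′ ls ⊎ (firstVacant r′ ls ≡ just x × r x ≡ 0)
firstVacant-OneMoreAt r⋖r′ [] = inj₁ refl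
firstVacant-OneMoreAt {x = x} {r} {r′} r⋖r′ (l ∷ ls) with l ≟ x
... | no l≢x with r l | r′ l | others r⋖r′ l≢x
...   | zero  | .zero    | refl = firstVacant-OneMoreAt r⋖r′ ls
...   | suc _ | .(suc _) | refl = inj₁ refl
firstVacant-OneMoreAt {x = x} {r} {r′} r⋖r′ (l ∷ ls) | yes refl with r l | r′ l | at r⋖r′
... | zero  | .1             | refl = inj₂ (refl , refl)
... | suc _ | .(suc (suc _)) | refl = inj₁ refl

m≤1+n⇒1+o≤q⇒m+o≤n+q : ∀ {m n o q} → m ≤ suc n → suc o ≤ q → m + o ≤ n + q
m≤1+n⇒1+o≤q⇒m+o≤n+q {n = n} {o} m≤1+n 1+o≤q =
  ≤-trans (+-monoˡ-≤ o m≤1+n) (≤-trans (≤-reflexive (sym (+-suc n o))) (+-monoʳ-≤ n 1+o≤q))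

module _ {c ℓ₁ ℓ₂} (U : StrictTotalOrder c ℓ₁ ℓ₂)
         (û : Fin n → StrictTotalOrder.Carrier U) (σ : Fin n → PrefList p) where

  open StableAlgorithm U

  unassigned : Assignment n p
  unassigned _ = nothing

  process-cong : ∀ is {r r′ : Capacities p} (a a′ : Assignment n p) → r ≗ r′ →
    differences (process û σ is r a) (process û σ is r′ a′) ≤ differences a a′
  process-cong [] a a′ r≗r′ = ≤-refl
  process-cong (i ∷ is) {r} {r′} a a′ r≗r′
    with firstVacant r (prefOrder (σ i)) | firstVacant r′ (prefOrder (σ i))
       | firstVacant-cong r≗r′ (prefOrder (σ i))
  ... | nothing | .nothing | refl = process-cong is a a′ r≗r′
  ... | just l  | .(just l) | refl =
    ≤-trans (process-cong is (assign i l a) (assign i l a′) (decCap-cong r≗r′ l))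
            (differences-assign i l a a′)

  -- In the last two cases candidate i takes the extra slot at x in the r′-run only: x is full
  -- from then on in both runs, and the extra slot moves to the institution b chosen in the r-run.
  process-OneMoreAt : ∀ is {x} {r r′ : Capacities p} (a a′ : Assignment n p) → OneMoreAt x r r′ →
    differences (process û σ is r a) (process û σ is r′ a′) ≤ differences a a′ + vacancies r′
  process-OneMoreAt [] a a′ r⋖r′ = m≤m+n _ _
  process-OneMoreAt (i ∷ is) {x} {r} {r′} a a′ r⋖r′
    with firstVacant r (prefOrder (σ i)) in choice | firstVacant r′ (prefOrder (σ i))
       | firstVacant-OneMoreAt r⋖r′ (prefOrder (σ i))
  ... | nothing | .nothing | inj₁ refl = process-OneMoreAt is a a′ r⋖r′
  ... | just l  | .(just l) | inj₁ refl =
    ≤-trans (process-OneMoreAt is (assign i l a) (assign i l a′)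
               (OneMoreAt-decCap (firstVacant-vacant r (prefOrder (σ i)) choice) r⋖r′))
            (+-mono-≤ (differences-assign i l a a′) (vacancies-decCap r′ l))
  ... | nothing | .(just x) | inj₂ (refl , rₓ≡0) =
    ≤-trans (process-cong is a (assign i x a′) (OneMoreAt⇒≗decCap r⋖r′))
            (≤-trans (m≤m+n _ _)
                     (m≤1+n⇒1+o≤q⇒m+o≤n+q (differences-agreeOutside i (λ _ → refl) (assign-other i x a′))
                                          (vacancies-decCap-< r′ (trans (at r⋖r′) (cong suc rₓ≡0)))))
  ... | just b  | .(just x) | inj₂ (refl , rₓ≡0) =
    ≤-trans (process-OneMoreAt is (assign i b a) (assign i x a′)
               (OneMoreAt-respʳ (decCap-OneMoreAt r (firstVacant-vacant r (prefOrder (σ i)) choice))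
                                (OneMoreAt⇒≗decCap r⋖r′)))
            (m≤1+n⇒1+o≤q⇒m+o≤n+q (differences-agreeOutside i (assign-other i b a) (assign-other i x a′))
                                 (vacancies-decCap-< r′ (trans (at r⋖r′) (cong suc rₓ≡0))))

  A-st-cong : {k k′ : Capacities p} → k ≗ k′ → differences (A-st û σ k) (A-st û σ k′) ≡ 0
  A-st-cong k≗k′ = n≤0⇒n≡0 (≤-trans (process-cong (byDecreasingUtility {p = p} û) unassigned unassigned k≗k′)
                                    (≤-reflexive (differences-self unassigned)))

  A-st-OneMoreAt : {x : Fin p} {k k′ : Capacities p} → OneMoreAt x k k′ →
                   differences (A-st û σ k) (A-st û σ k′) ≤ p
  A-st-OneMoreAt {k = k} {k′} k⋖k′ = begin
    differences (A-st û σ k) (A-st û σ k′)           ≤⟨ process-OneMoreAt (byDecreasingUtility {p = p} û)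
                                                            unassigned unassigned k⋖k′ ⟩
    differences unassigned unassigned + vacancies k′  ≡⟨ cong (_+ vacancies k′) (differences-self unassigned) ⟩
    vacancies k′                                      ≤⟨ count≤ _ ⟩
    p                                                 ∎
    where open ≤-Reasoning

corollary1 : {c ℓ₁ ℓ₂ : Level} (U : StrictTotalOrder c ℓ₁ ℓ₂) (n p : ℕ)
    (û : Fin n → StrictTotalOrder.Carrier U)
    → (∀ i j → StrictTotalOrder._≈_ U (û i) (û j) → i ≡ j)
    → (σ : Fin n → PrefList p)
    → (k k′ : Capacities p)
    → numDiffer (StableAlgorithm.A-st U û σ k) (StableAlgorithm.A-st U û σ k′)
        ≤ p * capDistance k k′
corollary1 U n p û _ σ k k′ = begin
  numDiffer (A k) (A k′)    ≡⟨ numDiffer≡differences (A k) (A k′) ⟩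
  differences (A k) (A k′)  ≤⟨ capDistance-Lipschitz (λ k k′ → differences (A k) (A k′)) p
                                 (A-st-cong U û σ) (λ k k′ → differences-sym (A k) (A k′))
                                 (λ k k′ k″ → differences-triangle (A k) (A k′) (A k″))
                                 (A-st-OneMoreAt U û σ) k k′ ⟩
  p * capDistance k k′      ∎
  where
  open ≤-Reasoning
  A : Capacities p → Assignment n p
  A = StableAlgorithm.A-st U û σ
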